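{- Let $E$ be a binary relation on $\mathbb{Q}^k$. If $E$ is smooth and preserved by $\min$, then $E$ contains a min-clean tuple.
   Context: A binary relation on $\mathbb{Q}^k$ is a nonempty $E\subseteq\mathbb{Q}^k\times\mathbb{Q}^k$; it is smooth if its sets of first and second components coincide. $\min$ is the binary minimum on $\mathbb{Q}$, applied componentwise to tuples; $E$ is preserved by $\min$ if it is closed under this componentwise application. For $a\in\mathbb{Q}^k$, $\min(a)$ is its least entry and $\mathrm{minx}(a)=\{i\in[k]:a_i=\min(a)\}$. For $t=(t_1,t_2)\in E$, $\min(t)=\min(\min(t_1),\min(t_2))$, $M(t)=\{i\in\{1,2\}:\min(t_i)=\min(t)\}$, and $t$ is min-clean if $\mathrm{minx}(t_i)=\mathrm{minx}(t_j)$ for all $i,j\in M(t)$. -}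

module Defs where

open import Data.Nat using (ℕ; zero; suc)
open import Data.Fin using (Fin; zero; suc)
open import Data.Rational using (ℚ; _⊓_)
open import Data.Product using (_×_; _,_; proj₁; proj₂; ∃)
open import Relation.Binary.PropositionalEquality using (_≡_)
open import Function.Bundles using (_⇔_)

Tuple : ℕ → Set
Tuple k = Fin k → ℚ

BinRel : ℕ → Set₁
BinRel k = Tuple k → Tuple k → Set

Nonempty : ∀ {k} → BinRel k → Set
Nonempty E = ∃ λ a → ∃ λ b → E a b

Smooth : ∀ {k} → BinRel k → Set
Smooth E = ∀ a → (∃ λ b → E a b) ⇔ (∃ λ b → E b a)

minᵗ : ∀ {k} → Tuple k → Tuple k → Tuple k
minᵗ a b i = a i ⊓ b i

PreservedByMin : ∀ {k} → BinRel k → Set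
PreservedByMin E = ∀ a b c d → E a b → E c d → E (minᵗ a c) (minᵗ b d)

minEntry : ∀ {n} → Tuple (suc n) → ℚ
minEntry {zero} a = a zero
minEntry {suc n} a = a zero ⊓ minEntry (λ i → a (suc i))

minx : ∀ {n} → Tuple (suc n) → Fin (suc n) → Set
minx a i = a i ≡ minEntry a

comp : ∀ {k} → Tuple k × Tuple k → Fin 2 → Tuple k
comp t zero = proj₁ t
comp t (suc _) = proj₂ t

minPair : ∀ {n} → Tuple (suc n) × Tuple (suc n) → ℚ
minPair t = minEntry (proj₁ t) ⊓ minEntry (proj₂ t)

M : ∀ {n} → Tuple (suc n) × Tuple (suc n) → Fin 2 → Set
M t i = minEntry (comp t i) ≡ minPair t

MinClean : ∀ {n} → Tuple (suc n) × Tuple (suc n) → Set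
MinClean t = ∀ i j → M t i → M t j →
  ∀ l → minx (comp t i) l ⇔ minx (comp t j) l

{-# OPTIONS --safe #-}
-- A pair with different minima is trivially min-clean, so start from a pair (x , y) ∈ E with
-- min x = min y = m.  Smoothness gives z and w with (y , z) , (w , x) ∈ E.  If min z < m or
-- min w < m, then (x ⊓ y , y ⊓ z) or (w ⊓ x , x ⊓ y) is a pair of E with different minima.
-- Otherwise u = (w ⊓ x) ⊓ (x ⊓ y) and v = (x ⊓ y) ⊓ (y ⊓ z) form a pair of E with minima m,
-- and both equal m at every index where x ⊓ y does.  If (u , v) is not min-clean, some index
-- lies in the m-level set of exactly one of u and v, hence in that of u ⊓ v but not of x ⊓ y:
-- the m-level set of x ⊓ y grows strictly, which can only happen finitely often.
module Submission where

open import Defs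
open import Data.Nat using (ℕ; suc)
open import Data.Product using (∃; ∃₂; _×_; _,_; uncurry)
open import Data.Sum using (_⊎_; inj₁; inj₂)
open import Data.Fin using (zero; suc)
open import Data.Fin.Properties using (all?; ¬∀⟶∃¬)
open import Data.Fin.Subset using (Subset; _∈_; _⊆_; _⊂_; _⊃_)
open import Data.Fin.Subset.Induction using (⊃-wellFounded)
open import Data.Vec using (tabulate)
open import Data.Vec.Properties using (lookup∘tabulate; []=⇒lookup; lookup⇒[]=)
open import Data.Rational using (ℚ; _⊓_; _≤_; _<_)
open import Data.Rational.Properties
  using (_≟_; _<?_; ≮⇒≥; <⇒≢; ≤-refl; ≤-trans; ≤-<-trans; ≤-reflexive;
         p≤q⇒p⊓q≡p; p≥q⇒p⊓q≡q; p⊓q≤p; p⊓q≤q; ⊓-glb; ⊓-commutativeSemigroup)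
open import Algebra.Properties.CommutativeSemigroup ⊓-commutativeSemigroup using (interchange)
open import Function.Bundles using (_⇔_; mk⇔; module Equivalence)
import Function.Properties.Equivalence as ⇔
open import Induction.WellFounded using (Acc; acc)
open import Relation.Nullary using (Dec; yes; no; ¬_; contradiction)
open import Relation.Nullary.Decidable using (map′; _×-dec_; _→-dec_; ⌊_⌋; toWitness; fromWitness)
open import Relation.Binary.PropositionalEquality
  using (_≡_; _≢_; refl; sym; trans; cong; subst; subst₂; ≢-sym; module ≡-Reasoning)
open import Data.Bool.Properties using (T-≡)

_⇔?_ : ∀ {A B : Set} → Dec A → Dec B → Dec (A ⇔ B)
a? ⇔? b? = map′ (uncurry mk⇔) (λ e → Equivalence.to e , Equivalence.from e)
                ((a? →-dec b?) ×-dec (b? →-dec a?))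

¬⇔⇒⊎ : ∀ {A B : Set} → Dec A → Dec B → ¬ (A ⇔ B) → A ⊎ B
¬⇔⇒⊎ (yes a) _       _   = inj₁ a
¬⇔⇒⊎ (no _)  (yes b) _   = inj₂ b
¬⇔⇒⊎ (no ¬a) (no ¬b) a≄b =
  contradiction (mk⇔ (λ a → contradiction a ¬a) (λ b → contradiction b ¬b)) a≄b

p≡r⊎q≡r⇒p⊓q≡r : ∀ {p q r} → r ≤ p → r ≤ q → p ≡ r ⊎ q ≡ r → p ⊓ q ≡ r
p≡r⊎q≡r⇒p⊓q≡r _   r≤q (inj₁ refl) = p≤q⇒p⊓q≡p r≤q
p≡r⊎q≡r⇒p⊓q≡r r≤p _   (inj₂ refl) = p≥q⇒p⊓q≡q r≤p

minEntry-≤ : ∀ {n} (a : Tuple (suc n)) i → minEntry a ≤ a i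
minEntry-≤ {ℕ.zero} a zero    = ≤-refl
minEntry-≤ {suc n}  a zero    = p⊓q≤p (a zero) _
minEntry-≤ {suc n}  a (suc i) = ≤-trans (p⊓q≤q (a zero) _) (minEntry-≤ (λ j → a (suc j)) i)

minEntry-minᵗ : ∀ {n} (a b : Tuple (suc n)) → minEntry (minᵗ a b) ≡ minEntry a ⊓ minEntry b
minEntry-minᵗ {ℕ.zero} a b = refl
minEntry-minᵗ {suc n}  a b = begin
  (a zero ⊓ b zero) ⊓ minEntry (minᵗ a′ b′)
    ≡⟨ cong ((a zero ⊓ b zero) ⊓_) (minEntry-minᵗ a′ b′) ⟩
  (a zero ⊓ b zero) ⊓ (minEntry a′ ⊓ minEntry b′)
    ≡⟨ interchange (a zero) (b zero) _ _ ⟩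
  (a zero ⊓ minEntry a′) ⊓ (b zero ⊓ minEntry b′) ∎
  where
  open ≡-Reasoning
  a′ b′ : Tuple (suc n)
  a′ i = a (suc i)
  b′ i = b (suc i)

minEntry-minᵗ-≤ˡ : ∀ {n} (a b : Tuple (suc n)) → minEntry (minᵗ a b) ≤ minEntry a
minEntry-minᵗ-≤ˡ a b = subst (_≤ minEntry a) (sym (minEntry-minᵗ a b)) (p⊓q≤p (minEntry a) _)

minEntry-minᵗ-≤ʳ : ∀ {n} (a b : Tuple (suc n)) → minEntry (minᵗ a b) ≤ minEntry b
minEntry-minᵗ-≤ʳ a b = subst (_≤ minEntry b) (sym (minEntry-minᵗ a b)) (p⊓q≤q (minEntry a) _)

≤-minEntry-minᵗ : ∀ {n m} (a b : Tuple (suc n)) → m ≤ minEntry a → m ≤ minEntry b →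
                  m ≤ minEntry (minᵗ a b)
≤-minEntry-minᵗ a b m≤a m≤b = subst (_ ≤_) (sym (minEntry-minᵗ a b)) (⊓-glb m≤a m≤b)

minEntry-minᵗ-≡ : ∀ {n m} (a b : Tuple (suc n)) → m ≤ minEntry a → m ≤ minEntry b →
                  minEntry a ≡ m ⊎ minEntry b ≡ m → minEntry (minᵗ a b) ≡ m
minEntry-minᵗ-≡ a b m≤a m≤b attained =
  trans (minEntry-minᵗ a b) (p≡r⊎q≡r⇒p⊓q≡r m≤a m≤b attained)

≤-entries : ∀ {n m} {a : Tuple (suc n)} → m ≤ minEntry a → ∀ i → m ≤ a i
≤-entries {a = a} m≤a i = ≤-trans m≤a (minEntry-≤ a i)

levelSet : ∀ {k} → ℚ → Tuple k → Subset k
levelSet m a = tabulate (λ i → ⌊ a i ≟ m ⌋)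

∈-levelSet⇔ : ∀ {k m} {a : Tuple k} {i} → i ∈ levelSet m a ⇔ a i ≡ m
∈-levelSet⇔ {m = m} {a} {i} = mk⇔ to from
  where
  to : i ∈ levelSet m a → a i ≡ m
  to i∈ = toWitness (Equivalence.from T-≡ (trans (sym (lookup∘tabulate _ i)) ([]=⇒lookup i∈)))
  from : a i ≡ m → i ∈ levelSet m a
  from e = lookup⇒[]= i _ (trans (lookup∘tabulate _ i) (Equivalence.to T-≡ (fromWitness e)))

SameLevelSet : ∀ {k} → ℚ → Tuple k → Tuple k → Set
SameLevelSet m a b = ∀ i → a i ≡ m ⇔ b i ≡ m

sameLevelSet⊎disagreement : ∀ {k} m (a b : Tuple k) →
                            SameLevelSet m a b ⊎ ∃ λ i → ¬ (a i ≡ m ⇔ b i ≡ m)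
sameLevelSet⊎disagreement {k} m a b = decide (all? agree-at?)
  where
  agree-at? : ∀ i → Dec (a i ≡ m ⇔ b i ≡ m)
  agree-at? i = (a i ≟ m) ⇔? (b i ≟ m)
  decide : Dec (SameLevelSet m a b) → SameLevelSet m a b ⊎ ∃ λ i → ¬ (a i ≡ m ⇔ b i ≡ m)
  decide (yes agree) = inj₁ agree
  decide (no ¬agree) = inj₂ (¬∀⟶∃¬ k _ agree-at? ¬agree)

minx⇔⇒minClean : ∀ {n} {x y : Tuple (suc n)} →
                 (minEntry x ≡ minEntry y → ∀ i → minx x i ⇔ minx y i) → MinClean (x , y)
minx⇔⇒minClean h zero    zero    _  _  i = ⇔.refl
minx⇔⇒minClean h zero    (suc _) Mx My i = h (trans Mx (sym My)) i
minx⇔⇒minClean h (suc _) zero    My Mx i = ⇔.sym (h (trans Mx (sym My)) i)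
minx⇔⇒minClean h (suc _) (suc _) _  _  i = ⇔.refl

minEntry≢⇒minClean : ∀ {n} {x y : Tuple (suc n)} → minEntry x ≢ minEntry y → MinClean (x , y)
minEntry≢⇒minClean x≢y = minx⇔⇒minClean (λ x≡y → contradiction x≡y x≢y)

sameLevelSet⇒minClean : ∀ {n m} {x y : Tuple (suc n)} → minEntry x ≡ m → minEntry y ≡ m →
                        SameLevelSet m x y → MinClean (x , y)
sameLevelSet⇒minClean {x = x} {y} x≡m y≡m agree =
  minx⇔⇒minClean (λ _ → subst₂ (λ p q → ∀ i → x i ≡ p ⇔ y i ≡ q) (sym x≡m) (sym y≡m) agree)

levelSet-⊂ : ∀ {k m} {p q r : Tuple k} {i} → (∀ j → m ≤ p j) → (∀ j → m ≤ q j) → (∀ j → m ≤ r j) →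
             ¬ (minᵗ p q i ≡ m ⇔ minᵗ q r i ≡ m) →
             levelSet m q ⊂ levelSet m (minᵗ (minᵗ p q) (minᵗ q r))
levelSet-⊂ {m = m} {p} {q} {r} {i} m≤p m≤q m≤r disagree = q⊆uv , i , i∈uv , i∉q
  where
  to : ∀ {a : Tuple _} {j} → j ∈ levelSet m a → a j ≡ m
  to = Equivalence.to ∈-levelSet⇔
  from : ∀ {a : Tuple _} {j} → a j ≡ m → j ∈ levelSet m a
  from = Equivalence.from ∈-levelSet⇔
  m≤u : ∀ j → m ≤ minᵗ p q j
  m≤u j = ⊓-glb (m≤p j) (m≤q j)
  m≤v : ∀ j → m ≤ minᵗ q r j
  m≤v j = ⊓-glb (m≤q j) (m≤r j)
  u≡m : ∀ {j} → q j ≡ m → minᵗ p q j ≡ m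
  u≡m q≡m = p≡r⊎q≡r⇒p⊓q≡r (m≤p _) (m≤q _) (inj₂ q≡m)
  v≡m : ∀ {j} → q j ≡ m → minᵗ q r j ≡ m
  v≡m q≡m = p≡r⊎q≡r⇒p⊓q≡r (m≤q _) (m≤r _) (inj₁ q≡m)
  q⊆uv : levelSet m q ⊆ levelSet m (minᵗ (minᵗ p q) (minᵗ q r))
  q⊆uv j∈q = from (p≡r⊎q≡r⇒p⊓q≡r (m≤u _) (m≤v _) (inj₁ (u≡m (to j∈q))))
  i∈uv : i ∈ levelSet m (minᵗ (minᵗ p q) (minᵗ q r))
  i∈uv = from (p≡r⊎q≡r⇒p⊓q≡r (m≤u i) (m≤v i) (¬⇔⇒⊎ (_ ≟ m) (_ ≟ m) disagree))
  i∉q : ¬ (i ∈ levelSet m q)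
  i∉q i∈q = disagree (mk⇔ (λ _ → v≡m (to i∈q)) (λ _ → u≡m (to i∈q)))

module _ {n} {E : BinRel (suc n)} (smooth : Smooth E) (pres : PreservedByMin E) where

  CleanPair : Set
  CleanPair = ∃ λ a → ∃ λ b → E a b × MinClean (a , b)

  PairAtLevel : ℚ → Tuple (suc n) → Tuple (suc n) → Set
  PairAtLevel m x y = E x y × minEntry x ≡ m × minEntry y ≡ m

  CleanPair⊎LevelSetGrows : ℚ → Tuple (suc n) → Tuple (suc n) → Set
  CleanPair⊎LevelSetGrows m x y =
    CleanPair ⊎ ∃₂ λ u v → PairAtLevel m u v × levelSet m (minᵗ x y) ⊂ levelSet m (minᵗ u v)

  minᵗ-atLevel : ∀ {m x y} → PairAtLevel m x y → minEntry (minᵗ x y) ≡ m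
  minᵗ-atLevel {x = x} {y} (_ , x≡m , y≡m) =
    minEntry-minᵗ-≡ x y (≤-reflexive (sym x≡m)) (≤-reflexive (sym y≡m)) (inj₁ x≡m)

  cleanPair⊎levelSetGrows-neighbours≥ : ∀ {m w x y z} → E w x → PairAtLevel m x y → E y z →
                 m ≤ minEntry w → m ≤ minEntry z → CleanPair⊎LevelSetGrows m x y
  cleanPair⊎levelSetGrows-neighbours≥ {m} {w} {x} {y} {z} ewx xy@(exy , x≡m , y≡m) eyz m≤w m≤z =
    conclude (sameLevelSet⊎disagreement m u v)
    where
    u v : Tuple (suc n)
    u = minᵗ (minᵗ w x) (minᵗ x y)
    v = minᵗ (minᵗ x y) (minᵗ y z)
    euv : E u v
    euv = pres _ _ _ _ (pres _ _ _ _ ewx exy) (pres _ _ _ _ exy eyz)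
    m≤x : m ≤ minEntry x
    m≤x = ≤-reflexive (sym x≡m)
    m≤y : m ≤ minEntry y
    m≤y = ≤-reflexive (sym y≡m)
    xy≡m : minEntry (minᵗ x y) ≡ m
    xy≡m = minᵗ-atLevel xy
    m≤xy : m ≤ minEntry (minᵗ x y)
    m≤xy = ≤-reflexive (sym xy≡m)
    m≤wx : m ≤ minEntry (minᵗ w x)
    m≤wx = ≤-minEntry-minᵗ w x m≤w m≤x
    m≤yz : m ≤ minEntry (minᵗ y z)
    m≤yz = ≤-minEntry-minᵗ y z m≤y m≤z
    u≡m : minEntry u ≡ m
    u≡m = minEntry-minᵗ-≡ (minᵗ w x) (minᵗ x y) m≤wx m≤xy (inj₂ xy≡m)
    v≡m : minEntry v ≡ m
    v≡m = minEntry-minᵗ-≡ (minᵗ x y) (minᵗ y z) m≤xy m≤yz (inj₁ xy≡m)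
    conclude : SameLevelSet m u v ⊎ ∃ (λ i → ¬ (u i ≡ m ⇔ v i ≡ m)) →
               CleanPair⊎LevelSetGrows m x y
    conclude (inj₁ agree)          = inj₁ (u , v , euv , sameLevelSet⇒minClean u≡m v≡m agree)
    conclude (inj₂ (_ , disagree)) =
      inj₂ (u , v , (euv , u≡m , v≡m) ,
            levelSet-⊂ (≤-entries m≤wx) (≤-entries m≤xy) (≤-entries m≤yz) disagree)

  cleanPair⊎levelSetGrows : ∀ {m x y} → PairAtLevel m x y → CleanPair⊎LevelSetGrows m x y
  cleanPair⊎levelSetGrows {m} {x} {y} xy@(exy , _)
    with z , eyz ← Equivalence.from (smooth y) (x , exy)
       | w , ewx ← Equivalence.to (smooth x) (y , exy)
       | minEntry z <? m | minEntry w <? m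
  ... | yes z<m | _       =
    inj₁ (minᵗ x y , minᵗ y z , pres _ _ _ _ exy eyz , minEntry≢⇒minClean (≢-sym (<⇒≢ yz<xy)))
    where
    yz<xy : minEntry (minᵗ y z) < minEntry (minᵗ x y)
    yz<xy = ≤-<-trans (minEntry-minᵗ-≤ʳ y z) (subst (minEntry z <_) (sym (minᵗ-atLevel xy)) z<m)
  ... | no _    | yes w<m =
    inj₁ (minᵗ w x , minᵗ x y , pres _ _ _ _ ewx exy , minEntry≢⇒minClean (<⇒≢ wx<xy))
    where
    wx<xy : minEntry (minᵗ w x) < minEntry (minᵗ x y)
    wx<xy = ≤-<-trans (minEntry-minᵗ-≤ˡ w x) (subst (minEntry w <_) (sym (minᵗ-atLevel xy)) w<m)
  ... | no z≮m  | no w≮m  = cleanPair⊎levelSetGrows-neighbours≥ ewx xy eyz (≮⇒≥ w≮m) (≮⇒≥ z≮m)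

  cleanPair-fromLevel : ∀ {m x y} → Acc _⊃_ (levelSet m (minᵗ x y)) → PairAtLevel m x y → CleanPair
  cleanPair-fromLevel (acc larger) xy with cleanPair⊎levelSetGrows xy
  ... | inj₁ clean                  = clean
  ... | inj₂ (_ , _ , uv , xy⊂uv) = cleanPair-fromLevel (larger xy⊂uv) uv

lemma5p1 : (n : ℕ) → (E : BinRel (suc n)) → Nonempty E → Smooth E → PreservedByMin E →
    ∃ λ a → ∃ λ b → E a b × MinClean (a , b)
lemma5p1 n E (a , b , eab) smooth pres with minEntry a ≟ minEntry b
... | no  a≢b = a , b , eab , minEntry≢⇒minClean a≢b
... | yes a≡b = cleanPair-fromLevel smooth pres (⊃-wellFounded _) (eab , refl , sym a≡b)
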